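{- Let $M$ be a square matrix over $\mathrm{GF}(2)$ with rows and columns indexed by a finite set $V$, and let $v\in V$ be isolated, i.e. $M_{uv}=M_{vu}=0$ for all $u\in V\setminus\{v\}$. Let $M'=M[V\setminus\{v\}]$. Then for each $\bullet\in\{\delta,\tau,\delta\tau,\tau\delta,\tau\delta\tau\}$, $P_{\langle\bullet\rangle}(M,z)=c_\bullet(M_{vv})\,P_{\langle\bullet\rangle}(M',z)$, where $c_\delta(0)=2$, $c_\delta(1)=2z$; $c_\tau(0)=c_\tau(1)=z+1$; $c_{\delta\tau}(0)=c_{\delta\tau}(1)=z+1$; $c_{\tau\delta}(0)=2$, $c_{\tau\delta}(1)=z+1$; $c_{\tau\delta\tau}(0)=2$, $c_{\tau\delta\tau}(1)=z+1$.
   Context: For $A\subseteq V$: $M[A]$ is the principal submatrix on $A$, $A^c=V\setminus A$, $I_A$ is the diagonal matrix with $(I_A)_{ii}=1$ for $i\in A$ and $0$ otherwise, and $\operatorname{corank}$ of a square matrix is its size minus its rank (empty matrices have rank $0$). Define $r_{\langle\delta\rangle}(M,A)=\operatorname{rank}(M[A])+\operatorname{rank}(M[A^c])$, $r_{\langle\tau\rangle}(M,A)=\operatorname{rank}(M+I_A)$, $r_{\langle\delta\tau\rangle}(M,A)=\operatorname{rank}((M+I_A)[A])+\operatorname{rank}(M[A^c])$, $r_{\langle\tau\delta\rangle}(M,A)=\operatorname{rank}(M+I_A)-\operatorname{corank}(M[A])$, $r_{\langle\tau\delta\tau\rangle}(M,A)=\operatorname{rank}(M)-\operatorname{corank}((M+I_A)[A])$,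 and $P_{\langle\bullet\rangle}(M,z)=\sum_{A\subseteq V} z^{r_{\langle\bullet\rangle}(M,A)}$, with $P_{\langle\bullet\rangle}=1$ for the empty matrix. -}

module Defs where

open import Data.Bool using (Bool; true; false; _∧_; _∨_; not; _xor_; if_then_else_)
open import Data.Nat using (ℕ; zero; suc; _+_; _*_; _∸_; _^_; _⊔_)
open import Data.Fin using (Fin; punchIn; _≟_)
open import Data.Fin.Subset using (Subset; outside; inside; ∣_∣; ∁; ⊤)
open import Data.List using (List; []; _∷_; [_]; map; foldr; _++_; allFin)
open import Data.Bool.ListAction using (all; any)
open import Data.Nat.ListAction using (sum)
open import Data.Vec using (_∷_; []; lookup)
open import Relation.Nullary using (does)

-- Square matrices over GF(2) (GF(2) = Bool with xor as +, ∧ as ·),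
-- rows and columns indexed by V = Fin n.
Mat : ℕ → Set
Mat n = Fin n → Fin n → Bool

allSubsets : (n : ℕ) → List (Subset n)
allSubsets zero = [ [] ]
allSubsets (suc n) = map (outside ∷_) (allSubsets n) ++ map (inside ∷_) (allSubsets n)

mem : ∀ {n} → Subset n → Fin n → Bool
mem S i = lookup S i

subB : ∀ {n} → Subset n → Subset n → Bool
subB {n} T S = all (λ i → not (mem T i) ∨ mem S i) (allFin n)

nonemptyB : ∀ {n} → Subset n → Bool
nonemptyB {n} T = any (mem T) (allFin n)

rowComb : ∀ {n} → Mat n → Subset n → Fin n → Bool
rowComb {n} M T j = foldr _xor_ false (map (λ i → mem T i ∧ M i j) (allFin n))

zeroOnB : ∀ {n} → Subset n → (Fin n → Bool) → Bool
zeroOnB {n} C w = all (λ j → not (mem C j) ∨ not (w j)) (allFin n)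

-- The rows of M indexed by S, restricted to the columns C, are linearly
-- independent over GF(2): no nonempty subset of them sums to zero.
indepB : ∀ {n} → Mat n → Subset n → Subset n → Bool
indepB {n} M C S =
  all (λ T → not (subB T S ∧ nonemptyB T) ∨ not (zeroOnB C (rowComb M T))) (allSubsets n)

rankSub : ∀ {n} → Mat n → Subset n → Subset n → ℕ
rankSub {n} M R C =
  foldr _⊔_ 0 (map (λ S → if subB S R ∧ indepB M C S then ∣ S ∣ else 0) (allSubsets n))

prank : ∀ {n} → Mat n → Subset n → ℕ
prank M A = rankSub M A A

pcorank : ∀ {n} → Mat n → Subset n → ℕ
pcorank M A = ∣ A ∣ ∸ prank M A

rank : ∀ {n} → Mat n → ℕ
rank M = prank M ⊤

addI : ∀ {n} → Mat n → Subset n → Mat n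
addI M A i j = if does (i ≟ j) then M i j xor mem A i else M i j

data Variant : Set where
  δ τ δτ τδ τδτ : Variant

r : Variant → ∀ {n} → Mat n → Subset n → ℕ
r δ   M A = prank M A + prank M (∁ A)
r τ   M A = rank (addI M A)
r δτ  M A = prank (addI M A) A + prank M (∁ A)
r τδ  M A = rank (addI M A) ∸ pcorank M A
r τδτ M A = rank M ∸ pcorank (addI M A) A

-- P_⟨•⟩(M, z) = Σ_{A ⊆ V} z^{r_⟨•⟩(M,A)}, evaluated at z ∈ ℕ
-- (for n = 0 the only subset is ∅ and every r is 0, giving 1).
P : Variant → ∀ {n} → Mat n → ℕ → ℕ
P b {n} M z = sum (map (λ A → z ^ r b M A) (allSubsets n))

c : Variant → Bool → ℕ → ℕ
c δ   false z = 2
c δ   true  z = 2 * z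
c τ   _     z = z + 1
c δτ  _     z = z + 1
c τδ  false z = 2
c τδ  true  z = z + 1
c τδτ false z = 2
c τδτ true  z = z + 1

-- M[V ∖ {v}], reindexed by Fin n via punchIn
deleteVertex : ∀ {n} → Fin (suc n) → Mat (suc n) → Mat n
deleteVertex v M i j = M (punchIn v i) (punchIn v j)

-- If v is isolated, M is block diagonal with blocks M′ = M[V ∖ {v}] and (M_vv), and so are M + I_A
-- and all principal submatrices occurring in r_•. Each rank in r_•(M, A) therefore splits into a
-- contribution of v, depending only on M_vv and on whether v ∈ A, plus the corresponding rank for M′;
-- pairing A with A ∪ {v} turns the sum over subsets of V into c_•(M_vv) times the sum for M′.
-- The one non-formal point is the truncated subtraction in r_τδ and r_τδτ. It is harmless because
-- corank(M[A]) ≤ rank(M + I_A) and corank((M + I_A)[A]) ≤ rank(M), both consequences of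
-- |A| ≤ rank(M[A]) + rank((M + I_A)[A]): subadditivity of rank applied to M[A] + (M + I_A)[A] = I.
-- With rank defined as the largest size of an independent set of rows, subadditivity is the
-- Steinitz exchange lemma.

module Submission where

open import Defs
open import Algebra.Bundles using (CommutativeRing)
open import Data.Bool using (Bool; true; false; _∧_; _∨_; not; _xor_; if_then_else_) renaming (_≟_ to _≟ᵇ_)
open import Data.Bool.Properties
  using (xor-∧-commutativeRing; xor-same; ∧-zeroʳ; ∧-distribˡ-xor; xor-assoc; xor-comm; xor-identityʳ; not-involutive; not-distribʳ-xor; xor-annihilates-not)
open import Data.Bool.ListAction using (all; any)
open import Data.Empty using (⊥; ⊥-elim)
open import Data.Fin using (Fin; punchIn; _≟_) renaming (zero to fzero; suc to fsuc)
open import Data.Fin.Properties using (punchInᵢ≢i; punchIn-injective; punchIn-punchOut; all?)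
open import Data.Fin.Subset using (Subset; ∣_∣; ∁; ⊤) renaming (⊥ to ∅)
open import Data.Fin.Subset.Properties using (∣⊥∣≡0; p⊆q⇒∣p∣≤∣q∣)
open import Data.List using (List; []; _∷_; map; foldr; _++_; allFin; tabulate; length)
open import Data.List.Properties using (map-tabulate; length-++; map-++; map-∘; map-cong)
open import Data.List.Membership.Propositional using (_∈_)
open import Data.List.Membership.Propositional.Properties
  using (∈-allFin; ∈-map⁺; ∈-map⁻; ∈-++⁺ˡ; ∈-++⁺ʳ; ∈-insert; foldr-selective)
open import Data.List.Relation.Unary.Any using (here; there)
open import Data.List.Relation.Unary.All as All using (All; []; _∷_)
open import Data.List.Relation.Binary.Subset.Propositional using (_⊆_)
open import Data.List.Relation.Binary.Subset.Propositional.Properties using (xs⊆x∷xs; xs⊆xs++ys; xs⊆ys++xs; ++⁺ʳ)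
open import Data.Nat.ListAction using (sum)
open import Data.Nat.ListAction.Properties using (sum-++)
open import Data.Nat using (ℕ; zero; suc; _+_; _*_; _∸_; _^_; _⊔_; _≤_; z≤n; s≤s)
open import Data.Nat.Properties using (+-suc; *-zeroʳ; *-identityʳ; *-distribˡ-+; *-distribʳ-+; ^-distribˡ-+-*; +-identityʳ; +-commutativeSemigroup; +-mono-≤; +-∸-assoc; +-comm; m≤n+o⇒m∸n≤o; ≤-refl; 1+n≰n; module ≤-Reasoning; ≤-trans; ≤-reflexive; ≤-antisym; m≤m⊔n; m≤n⊔m; ⊔-sel)
open import Data.Product using (∃; _×_; _,_; proj₁; proj₂)
open import Data.Sum using (_⊎_; inj₁; inj₂)
open import Data.Vec using (_∷_; []; lookup; insertAt; removeAt)
open import Data.Vec.Functional using (Vector; zipWith)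
open import Data.Vec.Properties
  using (map-insertAt; lookup-replicate; []=⇒lookup; lookup⇒[]=; insertAt-lookup; insertAt-punchIn; insertAt-removeAt)
open import Function using (_∘_; _⇔_; mk⇔; Equivalence)
open import Relation.Nullary using (¬_; Dec; yes; no; does; contradiction)
open import Relation.Nullary.Decidable using (dec-true; dec-false)
open import Relation.Binary.PropositionalEquality
  using (_≡_; _≢_; _≗_; refl; sym; trans; cong; cong₂; subst; module ≡-Reasoning)

open Equivalence using (to; from)
open import Algebra.Properties.CommutativeSemigroup +-commutativeSemigroup using (interchange)

open import Algebra.Properties.CommutativeMonoid.Sum
  (CommutativeRing.+-commutativeMonoid xor-∧-commutativeRing)
  using (sum-cong-≗; sum-remove; sum-replicate-zero)
  renaming (sum to xsum)

private
  variable
    n : ℕ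

foldr-xor-tabulate : ∀ {m} (f : Fin m → Bool) → foldr _xor_ false (tabulate f) ≡ xsum f
foldr-xor-tabulate {zero}  f = refl
foldr-xor-tabulate {suc m} f = cong (f fzero xor_) (foldr-xor-tabulate (f ∘ fsuc))

rowComb≡xsum : (M : Mat n) (T : Subset n) (j : Fin n) → rowComb M T j ≡ xsum (λ i → mem T i ∧ M i j)
rowComb≡xsum {n} M T j = trans (cong (foldr _xor_ false) (map-tabulate {n = n} (λ i → i) (λ i → mem T i ∧ M i j)))
                               (foldr-xor-tabulate (λ i → mem T i ∧ M i j))

xsum-zero : ∀ {m} {f : Fin m → Bool} → (∀ i → f i ≡ false) → xsum f ≡ false
xsum-zero {m} f≗0 = trans (sum-cong-≗ f≗0) (sum-replicate-zero m)

all≡true⇔ : ∀ {A : Set} (p : A → Bool) xs → all p xs ≡ true ⇔ (∀ {x} → x ∈ xs → p x ≡ true)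
all≡true⇔ p xs = mk⇔ (to-∀ xs) (from-∀ xs)
  where
  to-∀ : ∀ xs → all p xs ≡ true → ∀ {x} → x ∈ xs → p x ≡ true
  to-∀ (y ∷ ys) e m with p y in py
  to-∀ (y ∷ ys) e (here refl) | true = py
  to-∀ (y ∷ ys) e (there m)   | true = to-∀ ys e m
  from-∀ : ∀ xs → (∀ {x} → x ∈ xs → p x ≡ true) → all p xs ≡ true
  from-∀ []       _ = refl
  from-∀ (y ∷ ys) h rewrite h (here refl) = from-∀ ys (h ∘ there)

any≡true⇔ : ∀ {A : Set} (p : A → Bool) xs → any p xs ≡ true ⇔ ∃ (λ x → x ∈ xs × p x ≡ true)
any≡true⇔ p xs = mk⇔ (to-∃ xs) (λ (x , m , px) → from-∃ xs m px)
  where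
  to-∃ : ∀ xs → any p xs ≡ true → ∃ (λ x → x ∈ xs × p x ≡ true)
  to-∃ (y ∷ ys) e with p y in py
  ... | true  = y , here refl , py
  ... | false = let x , m , px = to-∃ ys e in x , there m , px
  from-∃ : ∀ xs {x} → x ∈ xs → p x ≡ true → any p xs ≡ true
  from-∃ (y ∷ ys) (here refl) px rewrite px = refl
  from-∃ (y ∷ ys) (there m)   px with p y
  ... | true  = refl
  ... | false = from-∃ ys m px

not∨≡true⇔ : ∀ x y → not x ∨ y ≡ true ⇔ (x ≡ true → y ≡ true)
not∨≡true⇔ false y = mk⇔ (λ _ ()) (λ _ → refl)
not∨≡true⇔ true  y = mk⇔ (λ y≡true _ → y≡true) (λ h → h refl)

not≡true⇔ : ∀ x → not x ≡ true ⇔ x ≡ false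
not≡true⇔ false = mk⇔ (λ _ → refl) (λ _ → refl)
not≡true⇔ true  = mk⇔ (λ ()) (λ ())

∧≡true⇔ : ∀ x y → x ∧ y ≡ true ⇔ (x ≡ true × y ≡ true)
∧≡true⇔ false y = mk⇔ (λ ()) (λ ())
∧≡true⇔ true  y = mk⇔ (λ y≡true → refl , y≡true) proj₂

xor≡false⇒≡ : ∀ {a b} → a xor b ≡ false → b ≡ a
xor≡false⇒≡ {false} b≡false = b≡false
xor≡false⇒≡ {true}  {true} _ = refl

xor-cancelˡ : ∀ w v → w xor (w xor v) ≡ v
xor-cancelˡ false v = refl
xor-cancelˡ true  v = not-involutive v

xor-cancel-both : ∀ w a b → (w xor a) xor (w xor b) ≡ a xor b
xor-cancel-both false a b = refl
xor-cancel-both true  a b = xor-annihilates-not a b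

xor-solveˡ : ∀ w {u v} → v ≡ w xor u → u ≡ w xor v
xor-solveˡ w {u} v≡w⊕u = trans (sym (xor-cancelˡ w u)) (cong (w xor_) (sym v≡w⊕u))

xor-swap : ∀ a w b → a xor (w xor b) ≡ w xor (a xor b)
xor-swap false w b = refl
xor-swap true  w b = not-distribʳ-xor w b

_⊆ₛ_ : Subset n → Subset n → Set
T ⊆ₛ S = ∀ i → mem T i ≡ true → mem S i ≡ true

Inhabited : Subset n → Set
Inhabited T = ∃ λ i → mem T i ≡ true

VanishesOn : Subset n → (Fin n → Bool) → Set
VanishesOn C w = ∀ j → mem C j ≡ true → w j ≡ false

Independent : Mat n → Subset n → Subset n → Set
Independent M C S = ∀ T → T ⊆ₛ S → Inhabited T → ¬ VanishesOn C (rowComb M T)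

subB≡true⇔ : (T S : Subset n) → subB T S ≡ true ⇔ T ⊆ₛ S
subB≡true⇔ {n} T S = mk⇔
  (λ e i → to (not∨≡true⇔ (mem T i) (mem S i)) (to (all≡true⇔ _ (allFin n)) e (∈-allFin i)))
  (λ T⊆S → from (all≡true⇔ _ (allFin n)) λ {i} _ → from (not∨≡true⇔ (mem T i) (mem S i)) (T⊆S i))

nonemptyB≡true⇔ : (T : Subset n) → nonemptyB T ≡ true ⇔ Inhabited T
nonemptyB≡true⇔ {n} T = mk⇔
  (λ e → let i , _ , Ti = to (any≡true⇔ (mem T) (allFin n)) e in i , Ti)
  (λ (i , Ti) → from (any≡true⇔ (mem T) (allFin n)) (i , ∈-allFin i , Ti))

zeroOnB≡true⇔ : (C : Subset n) (w : Fin n → Bool) → zeroOnB C w ≡ true ⇔ VanishesOn C w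
zeroOnB≡true⇔ {n} C w = mk⇔
  (λ e j Cj → to (not≡true⇔ (w j))
                 (to (not∨≡true⇔ (mem C j) (not (w j))) (to (all≡true⇔ _ (allFin n)) e (∈-allFin j)) Cj))
  (λ h → from (all≡true⇔ _ (allFin n)) λ {j} _ →
           from (not∨≡true⇔ (mem C j) (not (w j))) λ Cj → from (not≡true⇔ (w j)) (h j Cj))

∈-allSubsets : (T : Subset n) → T ∈ allSubsets n
∈-allSubsets []          = here refl
∈-allSubsets (false ∷ T) = ∈-++⁺ˡ (∈-map⁺ (false ∷_) (∈-allSubsets T))
∈-allSubsets (true ∷ T)  = ∈-++⁺ʳ _ (∈-map⁺ (true ∷_) (∈-allSubsets T))

indepB≡true⇔ : (M : Mat n) (C S : Subset n) → indepB M C S ≡ true ⇔ Independent M C S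
indepB≡true⇔ {n} M C S = mk⇔
  (λ e T T⊆S T≠∅ vanish →
     to (excludes (subB T S) (nonemptyB T) (zeroOnB C (rowComb M T)))
        (to (all≡true⇔ _ (allSubsets n)) e (∈-allSubsets T))
        (from (subB≡true⇔ T S) T⊆S) (from (nonemptyB≡true⇔ T) T≠∅) (from (zeroOnB≡true⇔ C _) vanish))
  (λ indep → from (all≡true⇔ _ (allSubsets n)) λ {T} _ →
     from (excludes (subB T S) (nonemptyB T) (zeroOnB C (rowComb M T)))
       λ T⊆S T≠∅ vanish → indep T (to (subB≡true⇔ T S) T⊆S) (to (nonemptyB≡true⇔ T) T≠∅)
                                   (to (zeroOnB≡true⇔ C _) vanish))
  where
  excludes : ∀ a b c → not (a ∧ b) ∨ not c ≡ true ⇔ (a ≡ true → b ≡ true → c ≢ true)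
  excludes false b     c     = mk⇔ (λ _ ()) (λ _ → refl)
  excludes true  false c     = mk⇔ (λ _ _ ()) (λ _ → refl)
  excludes true  true  false = mk⇔ (λ _ _ _ ()) (λ _ → refl)
  excludes true  true  true  = mk⇔ (λ ()) (λ h → contradiction refl (h refl refl))

mem-∅ : (i : Fin n) → mem ∅ i ≡ false
mem-∅ i = lookup-replicate i false

∅⊆ₛ : (S : Subset n) → ∅ ⊆ₛ S
∅⊆ₛ S i ∅i = contradiction (trans (sym (mem-∅ i)) ∅i) λ ()

∅-independent : (M : Mat n) (C : Subset n) → Independent M C ∅
∅-independent M C T T⊆∅ (i , Ti) _ = contradiction (trans (sym (mem-∅ i)) (T⊆∅ i Ti)) λ ()

∈⇒≤foldr-⊔ : ∀ {x xs} → x ∈ xs → x ≤ foldr _⊔_ 0 xs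
∈⇒≤foldr-⊔ {xs = y ∷ ys} (here refl) = m≤m⊔n y _
∈⇒≤foldr-⊔ {xs = y ∷ ys} (there m)   = ≤-trans (∈⇒≤foldr-⊔ m) (m≤n⊔m y _)

∣S∣≤rankSub : (M : Mat n) (R C S : Subset n) → S ⊆ₛ R → Independent M C S → ∣ S ∣ ≤ rankSub M R C
∣S∣≤rankSub {n} M R C S S⊆R indep = subst (_≤ rankSub M R C) (weight≡∣S∣)
  (∈⇒≤foldr-⊔ (∈-map⁺ (λ S → if subB S R ∧ indepB M C S then ∣ S ∣ else 0) (∈-allSubsets S)))
  where
  weight≡∣S∣ : (if subB S R ∧ indepB M C S then ∣ S ∣ else 0) ≡ ∣ S ∣
  weight≡∣S∣ rewrite from (subB≡true⇔ S R) S⊆R | from (indepB≡true⇔ M C S) indep = refl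

record RowBasis (M : Mat n) (R C : Subset n) : Set where
  field
    rows        : Subset n
    rows⊆R      : rows ⊆ₛ R
    independent : Independent M C rows
    ∣rows∣≡rank  : ∣ rows ∣ ≡ rankSub M R C

rowBasis : (M : Mat n) (R C : Subset n) → RowBasis M R C
rowBasis {n} M R C = fromMaximum (foldr-selective ⊔-sel 0 (map weight (allSubsets n)))
  where
  weight : Subset n → ℕ
  weight S = if subB S R ∧ indepB M C S then ∣ S ∣ else 0

  empty : rankSub M R C ≡ 0 → RowBasis M R C
  empty rank≡0 = record { rows = ∅ ; rows⊆R = ∅⊆ₛ R
                        ; independent = ∅-independent M C ; ∣rows∣≡rank = trans (∣⊥∣≡0 n) (sym rank≡0) }

  fromMaximum : (rankSub M R C ≡ 0) ⊎ (rankSub M R C ∈ map weight (allSubsets n)) → RowBasis M R C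
  fromMaximum (inj₁ rank≡0) = empty rank≡0
  fromMaximum (inj₂ rank∈) with ∈-map⁻ weight rank∈
  ... | S , _ , rank≡ with subB S R ∧ indepB M C S in e
  ...   | true  = let S⊆R , indep = to (∧≡true⇔ _ _) e in
                  record { rows = S ; rows⊆R = to (subB≡true⇔ S R) S⊆R
                         ; independent = to (indepB≡true⇔ M C S) indep ; ∣rows∣≡rank = sym rank≡ }
  ...   | false = empty rank≡

⊆ₛ⇒∣∣≤ : {T S : Subset n} → T ⊆ₛ S → ∣ T ∣ ≤ ∣ S ∣
⊆ₛ⇒∣∣≤ {T = T} {S} T⊆S = p⊆q⇒∣p∣≤∣q∣ {p = T} λ {i} i∈T → lookup⇒[]= i S (T⊆S i ([]=⇒lookup i∈T))

rowComb-cong : {M M′ : Mat n} → (∀ i j → M i j ≡ M′ i j) → (T : Subset n) → rowComb M T ≗ rowComb M′ T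
rowComb-cong {M = M} {M′} M≡M′ T j = begin
  rowComb M T j                    ≡⟨ rowComb≡xsum M T j ⟩
  xsum (λ i → mem T i ∧ M i j)     ≡⟨ sum-cong-≗ (λ i → cong (mem T i ∧_) (M≡M′ i j)) ⟩
  xsum (λ i → mem T i ∧ M′ i j)    ≡⟨ rowComb≡xsum M′ T j ⟨
  rowComb M′ T j                   ∎
  where open ≡-Reasoning

rankSub-cong : {M M′ : Mat n} → (∀ i j → M i j ≡ M′ i j) → (R C : Subset n) → rankSub M R C ≡ rankSub M′ R C
rankSub-cong {M = M} {M′} M≡M′ R C = ≤-antisym (≤-transport M≡M′) (≤-transport (λ i j → sym (M≡M′ i j)))
  where
  ≤-transport : {X Y : Mat _} → (∀ i j → X i j ≡ Y i j) → rankSub X R C ≤ rankSub Y R C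
  ≤-transport {X} {Y} X≡Y = let open RowBasis (rowBasis X R C) in
    subst (_≤ rankSub Y R C) ∣rows∣≡rank
      (∣S∣≤rankSub Y R C rows rows⊆R λ T T⊆S T≠∅ vanish →
         independent T T⊆S T≠∅ λ j Cj → trans (rowComb-cong X≡Y T j) (vanish j Cj))

rankSub-mono : (M : Mat n) (R R′ C C′ : Subset n) → R ⊆ₛ R′ → C ⊆ₛ C′ → rankSub M R C ≤ rankSub M R′ C′
rankSub-mono M R R′ C C′ R⊆R′ C⊆C′ = let open RowBasis (rowBasis M R C) in
  subst (_≤ rankSub M R′ C′) ∣rows∣≡rank
    (∣S∣≤rankSub M R′ C′ rows (λ i → R⊆R′ i ∘ rows⊆R i) λ T T⊆S T≠∅ vanish →
       independent T T⊆S T≠∅ λ j Cj → vanish j (C⊆C′ j Cj))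

prank≤rank : (M : Mat n) (A : Subset n) → prank M A ≤ rank M
prank≤rank M A = rankSub-mono M A ⊤ A ⊤ (λ i _ → lookup-replicate i true) (λ j _ → lookup-replicate j true)

prank≤∣A∣ : (M : Mat n) (A : Subset n) → prank M A ≤ ∣ A ∣
prank≤∣A∣ M A = let open RowBasis (rowBasis M A A) in
  subst (_≤ ∣ A ∣) ∣rows∣≡rank (⊆ₛ⇒∣∣≤ {T = rows} {A} rows⊆R)

bit : Bool → ℕ
bit false = 0
bit true  = 1

bit-mono : ∀ {x y} → (x ≡ true → y ≡ true) → bit x ≤ bit y
bit-mono {false}         _   = z≤n
bit-mono {true}  {true}  _   = ≤-refl
bit-mono {true}  {false} x⇒y = contradiction (x⇒y refl) λ ()

∣insertAt∣ : (A : Subset n) (i : Fin (suc n)) (b : Bool) → ∣ insertAt A i b ∣ ≡ bit b + ∣ A ∣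
∣insertAt∣ A           fzero    false = refl
∣insertAt∣ A           fzero    true  = refl
∣insertAt∣ (false ∷ A) (fsuc i) b     = ∣insertAt∣ A i b
∣insertAt∣ (true ∷ A)  (fsuc i) b     = trans (cong suc (∣insertAt∣ A i b)) (sym (+-suc (bit b) ∣ A ∣))

data InsertAtView (i : Fin (suc n)) : Subset (suc n) → Set where
  insertAt-view : (T : Subset n) (t : Bool) → InsertAtView i (insertAt T i t)

insertAtView : (i : Fin (suc n)) (T : Subset (suc n)) → InsertAtView i T
insertAtView i T = subst (InsertAtView i) (insertAt-removeAt T i) (insertAt-view (removeAt T i) (lookup T i))

punchIn-cases : {P : Fin (suc n) → Set} (i : Fin (suc n)) → P i → (∀ k → P (punchIn i k)) → ∀ j → P j
punchIn-cases {P = P} i Pi Pk j with j ≟ i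
... | yes refl = Pi
... | no  j≢i  = subst P (punchIn-punchOut (j≢i ∘ sym)) (Pk _)

⊆ₛ-insertAt⇔ : (T S : Subset n) (i : Fin (suc n)) (t s : Bool) →
               insertAt T i t ⊆ₛ insertAt S i s ⇔ ((t ≡ true → s ≡ true) × T ⊆ₛ S)
⊆ₛ-insertAt⇔ T S i t s = mk⇔
  (λ ⊆ → (λ t≡true → trans (sym (insertAt-lookup S i s)) (⊆ i (trans (insertAt-lookup T i t) t≡true)))
       , (λ k Tk → trans (sym (insertAt-punchIn S i s k)) (⊆ (punchIn i k) (trans (insertAt-punchIn T i t k) Tk))))
  (λ (t⇒s , T⊆S) → punchIn-cases i
     (λ Ti → trans (insertAt-lookup S i s) (t⇒s (trans (sym (insertAt-lookup T i t)) Ti)))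
     (λ k Tk → trans (insertAt-punchIn S i s k) (T⊆S k (trans (sym (insertAt-punchIn T i t k)) Tk))))

Inhabited-insertAt⇔ : (T : Subset n) (i : Fin (suc n)) (t : Bool) →
                      Inhabited (insertAt T i t) ⇔ (t ≡ true ⊎ Inhabited T)
Inhabited-insertAt⇔ T i t = mk⇔
  (λ (j , Tj) → punchIn-cases {P = λ j → mem (insertAt T i t) j ≡ true → t ≡ true ⊎ Inhabited T} i
     (λ Ti → inj₁ (trans (sym (insertAt-lookup T i t)) Ti))
     (λ k Tk → inj₂ (k , trans (sym (insertAt-punchIn T i t k)) Tk)) j Tj)
  λ { (inj₁ t≡true) → i , trans (insertAt-lookup T i t) t≡true
    ; (inj₂ (k , Tk)) → punchIn i k , trans (insertAt-punchIn T i t k) Tk }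

VanishesOn-insertAt⇔ : (C : Subset n) (i : Fin (suc n)) (c : Bool) (w : Vector Bool (suc n)) →
                       VanishesOn (insertAt C i c) w ⇔ ((c ≡ true → w i ≡ false) × VanishesOn C (w ∘ punchIn i))
VanishesOn-insertAt⇔ C i c w = mk⇔
  (λ vanish → (λ c≡true → vanish i (trans (insertAt-lookup C i c) c≡true))
            , (λ k Ck → vanish (punchIn i k) (trans (insertAt-punchIn C i c k) Ck)))
  (λ (at-i , off-i) → punchIn-cases i
     (λ Ci → at-i (trans (sym (insertAt-lookup C i c)) Ci))
     (λ k Ck → off-i k (trans (sym (insertAt-punchIn C i c k)) Ck)))

rowComb-insertAt : (M : Mat (suc n)) (T : Subset n) (i : Fin (suc n)) (t : Bool) (j : Fin (suc n)) →
                   rowComb M (insertAt T i t) j ≡ (t ∧ M i j) xor xsum (λ k → mem T k ∧ M (punchIn i k) j)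
rowComb-insertAt M T i t j = begin
  rowComb M (insertAt T i t) j
    ≡⟨ rowComb≡xsum M (insertAt T i t) j ⟩
  xsum (λ l → mem (insertAt T i t) l ∧ M l j)
    ≡⟨ sum-remove {i = i} (λ l → mem (insertAt T i t) l ∧ M l j) ⟩
  (mem (insertAt T i t) i ∧ M i j) xor xsum (λ k → mem (insertAt T i t) (punchIn i k) ∧ M (punchIn i k) j)
    ≡⟨ cong₂ _xor_ (cong (_∧ M i j) (insertAt-lookup T i t))
                   (sum-cong-≗ λ k → cong (_∧ M (punchIn i k) j) (insertAt-punchIn T i t k)) ⟩
  (t ∧ M i j) xor xsum (λ k → mem T k ∧ M (punchIn i k) j)
    ∎
  where open ≡-Reasoning

-- Spans over GF(2) and the Steinitz exchange lemma

_⊕_ : ∀ {m} → Vector Bool m → Vector Bool m → Vector Bool m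
_⊕_ = zipWith _xor_

data InSpan {m : ℕ} : List (Vector Bool m) → Vector Bool m → Set where
  none : ∀ {v} → (∀ j → v j ≡ false) → InSpan [] v
  skip : ∀ {w ws v} → InSpan ws v → InSpan (w ∷ ws) v
  take : ∀ {w ws u v} → InSpan ws u → v ≗ w ⊕ u → InSpan (w ∷ ws) v

_⊑_ : ∀ {m} → List (Vector Bool m) → List (Vector Bool m) → Set
xs ⊑ ys = ∀ {v} → InSpan xs v → InSpan ys v

data IndependentOver {m : ℕ} (ps : List (Vector Bool m)) : List (Vector Bool m) → Set where
  []  : IndependentOver ps []
  _∷_ : ∀ {u us} → ¬ InSpan ps u → IndependentOver (u ∷ ps) us → IndependentOver ps (u ∷ us)

module _ {m : ℕ} where

  InSpan-resp : ∀ {ws} {v v′ : Vector Bool m} → v ≗ v′ → InSpan ws v → InSpan ws v′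
  InSpan-resp v≗v′ (none v≗0)   = none λ j → trans (sym (v≗v′ j)) (v≗0 j)
  InSpan-resp v≗v′ (skip v∈)    = skip (InSpan-resp v≗v′ v∈)
  InSpan-resp v≗v′ (take u∈ v≗) = take u∈ λ j → trans (sym (v≗v′ j)) (v≗ j)

  InSpan-zero : ∀ ws {v : Vector Bool m} → (∀ j → v j ≡ false) → InSpan ws v
  InSpan-zero []       v≗0 = none v≗0
  InSpan-zero (w ∷ ws) v≗0 = skip (InSpan-zero ws v≗0)

  InSpan-⊕ : ∀ {ws} {a b v : Vector Bool m} → InSpan ws a → InSpan ws b → v ≗ a ⊕ b → InSpan ws v
  InSpan-⊕ (none a≗0) (none b≗0) v≗ = none λ j → trans (v≗ j) (cong₂ _xor_ (a≗0 j) (b≗0 j))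
  InSpan-⊕ (skip a∈) (skip b∈) v≗ = skip (InSpan-⊕ a∈ b∈ v≗)
  InSpan-⊕ {w ∷ _} {b = b} (take {u = a′} a′∈ a≗) (skip b∈) v≗ =
    take (InSpan-⊕ a′∈ b∈ (λ _ → refl)) λ j →
      trans (v≗ j) (trans (cong (_xor b j) (a≗ j)) (xor-assoc (w j) (a′ j) (b j)))
  InSpan-⊕ {w ∷ _} {a} (skip a∈) (take {u = b′} b′∈ b≗) v≗ =
    take (InSpan-⊕ a∈ b′∈ (λ _ → refl)) λ j →
      trans (v≗ j) (trans (cong (a j xor_) (b≗ j)) (xor-swap (a j) (w j) (b′ j)))
  InSpan-⊕ {w ∷ _} (take {u = a′} a′∈ a≗) (take {u = b′} b′∈ b≗) v≗ =
    skip (InSpan-⊕ a′∈ b′∈ λ j →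
      trans (v≗ j) (trans (cong₂ _xor_ (a≗ j) (b≗ j)) (xor-cancel-both (w j) (a′ j) (b′ j))))

  InSpan-∈ : ∀ {ws} {x : Vector Bool m} → x ∈ ws → InSpan ws x
  InSpan-∈ {w ∷ ws} (here refl) = take (InSpan-zero ws (λ _ → refl)) λ j → sym (xor-identityʳ (w j))
  InSpan-∈ (there x∈)           = skip (InSpan-∈ x∈)

  ⊑-generators : ∀ {xs ys : List (Vector Bool m)} → (∀ {x} → x ∈ xs → InSpan ys x) → xs ⊑ ys
  ⊑-generators {ys = ys} gen (none v≗0)   = InSpan-zero ys v≗0
  ⊑-generators           gen (skip v∈)    = ⊑-generators (gen ∘ there) v∈
  ⊑-generators           gen (take u∈ v≗) = InSpan-⊕ (gen (here refl)) (⊑-generators (gen ∘ there) u∈) v≗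

  ⊆⇒⊑ : ∀ {xs ys : List (Vector Bool m)} → xs ⊆ ys → xs ⊑ ys
  ⊆⇒⊑ xs⊆ys = ⊑-generators (InSpan-∈ ∘ xs⊆ys)

  ∷-⊑ : ∀ {w} {xs ys : List (Vector Bool m)} → xs ⊑ ys → (w ∷ xs) ⊑ (w ∷ ys)
  ∷-⊑ xs⊑ys (skip v∈)    = skip (xs⊑ys v∈)
  ∷-⊑ xs⊑ys (take u∈ v≗) = take (xs⊑ys u∈) v≗

  InSpan? : ∀ ws (v : Vector Bool m) → Dec (InSpan ws v)
  InSpan? []       v with all? (λ j → v j ≟ᵇ false)
  ... | yes v≗0 = yes (none v≗0)
  ... | no  v≢0 = no λ { (none v≗0) → v≢0 v≗0 }
  InSpan? (w ∷ ws) v with InSpan? ws v | InSpan? ws (w ⊕ v)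
  ... | yes v∈ | _       = yes (skip v∈)
  ... | no  _  | yes w⊕v∈ = yes (take w⊕v∈ λ j → sym (xor-cancelˡ (w j) (v j)))
  ... | no  v∉ | no  w⊕v∉ = no λ { (skip v∈) → v∉ v∈
                                 ; (take u∈ v≗) → w⊕v∉ (InSpan-resp (λ j → xor-solveˡ (w j) (v≗ j)) u∈) }

  exchange : ∀ ws {ps} {u : Vector Bool m} → InSpan (ws ++ ps) u → ¬ InSpan ps u →
             ∃ λ ws′ → suc (length ws′) ≡ length ws × (ws ++ ps) ⊑ (ws′ ++ u ∷ ps)
  exchange []       u∈ u∉ = contradiction u∈ u∉
  exchange (w ∷ ws) (skip u∈) u∉ =
    let ws′ , ∣ws′∣ , ⊑ws′ = exchange ws u∈ u∉ in w ∷ ws′ , cong suc ∣ws′∣ , ∷-⊑ ⊑ws′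
  exchange (w ∷ ws) {ps} {u} (take {u = u′} u′∈ u≗) u∉ = ws , refl , ⊑-generators generator
    where
    ps⊆u∷ps : ws ++ ps ⊆ ws ++ u ∷ ps
    ps⊆u∷ps = ++⁺ʳ ws (xs⊆x∷xs ps u)

    w≗u⊕u′ : w ≗ u ⊕ u′
    w≗u⊕u′ j = trans (xor-solveˡ (u′ j) (trans (u≗ j) (xor-comm (w j) (u′ j)))) (xor-comm (u′ j) (u j))

    generator : ∀ {x} → x ∈ w ∷ ws ++ ps → InSpan (ws ++ u ∷ ps) x
    generator (here refl) = InSpan-⊕ (InSpan-∈ (∈-insert ws)) (⊆⇒⊑ ps⊆u∷ps u′∈) w≗u⊕u′
    generator (there x∈)  = InSpan-∈ (ps⊆u∷ps x∈)

  steinitz : ∀ {ps us} ws → IndependentOver ps us → All (InSpan (ws ++ ps)) us → length us ≤ length ws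
  steinitz ws _           []           = z≤n
  steinitz ws (u∉ ∷ indep) (u∈ ∷ us∈) =
    let ws′ , ∣ws′∣ , ⊑ws′ = exchange ws u∈ u∉ in
    ≤-trans (s≤s (steinitz ws′ indep (All.map ⊑ws′ us∈))) (≤-reflexive ∣ws′∣)

-- Subadditivity of rank

restrict : Subset n → Vector Bool n → Vector Bool n
restrict C w j = mem C j ∧ w j

rowSum : ∀ {k} → (Fin k → Vector Bool n) → Subset k → Vector Bool n
rowSum F T j = xsum (λ i → mem T i ∧ F i j)

rowList : ∀ {k} → (Fin k → Vector Bool n) → Subset n → Subset k → List (Vector Bool n)
rowList F C []          = []
rowList F C (false ∷ S) = rowList (F ∘ fsuc) C S
rowList F C (true ∷ S)  = restrict C (F fzero) ∷ rowList (F ∘ fsuc) C S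

length-rowList : ∀ {k} (F : Fin k → Vector Bool n) (C : Subset n) (S : Subset k) → length (rowList F C S) ≡ ∣ S ∣
length-rowList F C []          = refl
length-rowList F C (false ∷ S) = length-rowList (F ∘ fsuc) C S
length-rowList F C (true ∷ S)  = cong suc (length-rowList (F ∘ fsuc) C S)

All-rowList : ∀ {k} {P : Vector Bool n → Set} (F : Fin k → Vector Bool n) (C : Subset n) (S : Subset k) →
              (∀ i → mem S i ≡ true → P (restrict C (F i))) → All P (rowList F C S)
All-rowList F C []          _ = []
All-rowList F C (false ∷ S) h = All-rowList (F ∘ fsuc) C S (h ∘ fsuc)
All-rowList F C (true ∷ S)  h = h fzero refl ∷ All-rowList (F ∘ fsuc) C S (h ∘ fsuc)

∈-rowList : ∀ {k} (F : Fin k → Vector Bool n) (C : Subset n) (S : Subset k) (i : Fin k) →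
            mem S i ≡ true → restrict C (F i) ∈ rowList F C S
∈-rowList F C (true ∷ S)  fzero    _  = here refl
∈-rowList F C (true ∷ S)  (fsuc i) Si = there (∈-rowList (F ∘ fsuc) C S i Si)
∈-rowList F C (false ∷ S) (fsuc i) Si = ∈-rowList (F ∘ fsuc) C S i Si

InSpan-rowSum : ∀ {k} (F : Fin k → Vector Bool n) (C : Subset n) (T S : Subset k) →
                T ⊆ₛ S → InSpan (rowList F C S) (restrict C (rowSum F T))
InSpan-rowSum F C []          []          _   = none λ j → ∧-zeroʳ (mem C j)
InSpan-rowSum F C (false ∷ T) (false ∷ S) T⊆S = InSpan-rowSum (F ∘ fsuc) C T S (T⊆S ∘ fsuc)
InSpan-rowSum F C (false ∷ T) (true ∷ S)  T⊆S = skip (InSpan-rowSum (F ∘ fsuc) C T S (T⊆S ∘ fsuc))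
InSpan-rowSum F C (true ∷ T)  (true ∷ S)  T⊆S =
  take (InSpan-rowSum (F ∘ fsuc) C T S (T⊆S ∘ fsuc)) λ j → ∧-distribˡ-xor (mem C j) (F fzero j) _
InSpan-rowSum F C (true ∷ T)  (false ∷ S) T⊆S = contradiction (T⊆S fzero refl) λ ()

IndependentOver-rowList : ∀ {k} (F : Fin k → Vector Bool n) (C : Subset n) (S : Subset k) {ps} →
                          (∀ T → T ⊆ₛ S → Inhabited T → ¬ InSpan ps (restrict C (rowSum F T))) →
                          IndependentOver ps (rowList F C S)
IndependentOver-rowList F C []          _     = []
IndependentOver-rowList F C (false ∷ S) sums∉ =
  IndependentOver-rowList (F ∘ fsuc) C S λ T T⊆S (i , Ti) →
    sums∉ (false ∷ T) (λ { fzero () ; (fsuc i) → T⊆S i }) (fsuc i , Ti)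
IndependentOver-rowList {n} F C (true ∷ S) {ps} sums∉ = head∉ ∷ IndependentOver-rowList (F ∘ fsuc) C S tail∉
  where
  head : Vector Bool n
  head = restrict C (F fzero)

  rowSum-singleton : rowSum F (true ∷ ∅) ≗ F fzero
  rowSum-singleton j =
    trans (cong (F fzero j xor_) (xsum-zero λ i → cong (_∧ F (fsuc i) j) (mem-∅ i))) (xor-identityʳ (F fzero j))

  head∉ : ¬ InSpan ps head
  head∉ head∈ = sums∉ (true ∷ ∅) (λ { fzero _ → refl ; (fsuc i) → ∅⊆ₛ S i })
    (fzero , refl)
    (InSpan-resp (λ j → cong (mem C j ∧_) (sym (rowSum-singleton j))) head∈)

  tail∉ : ∀ T → T ⊆ₛ S → Inhabited T → ¬ InSpan (head ∷ ps) (restrict C (rowSum (F ∘ fsuc) T))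
  tail∉ T T⊆S (i , Ti) (skip sum∈) = sums∉ (false ∷ T) (λ { fzero () ; (fsuc i) → T⊆S i }) (fsuc i , Ti) sum∈
  tail∉ T T⊆S _ (take {u = u} u∈ sum≗) =
    sums∉ (true ∷ T) (λ { fzero _ → refl ; (fsuc i) → T⊆S i }) (fzero , refl) (InSpan-resp u≗sum u∈)
    where
    u≗sum : u ≗ restrict C (rowSum F (true ∷ T))
    u≗sum j = begin
      u j                                                  ≡⟨ xor-cancelˡ (head j) (u j) ⟨
      head j xor (head j xor u j)                          ≡⟨ cong (head j xor_) (sum≗ j) ⟨
      head j xor restrict C (rowSum (F ∘ fsuc) T) j        ≡⟨ ∧-distribˡ-xor (mem C j) (F fzero j) _ ⟨
      restrict C (rowSum F (true ∷ T)) j                   ∎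
      where open ≡-Reasoning

Independent⇒IndependentOver : (M : Mat n) (C S : Subset n) → Independent M C S → IndependentOver [] (rowList M C S)
Independent⇒IndependentOver M C S indep = IndependentOver-rowList M C S λ
  { T T⊆S T≠∅ (none sum≗0) → indep T T⊆S T≠∅ λ j Cj →
      trans (rowComb≡xsum M T j) (trans (sym (cong (_∧ rowSum M T j) Cj)) (sum≗0 j)) }

restrict-cong : {C : Subset n} {a b : Vector Bool n} →
                (∀ j → mem C j ≡ true → a j ≡ b j) → restrict C a ≗ restrict C b
restrict-cong {C = C} a≡b j with mem C j in Cj
... | false = refl
... | true  = a≡b j Cj

Independent-extend : (M : Mat (suc n)) (C : Subset (suc n)) (S : Subset n) (i : Fin (suc n)) →
                     ¬ InSpan (rowList M C (insertAt S i false)) (restrict C (M i)) →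
                     Independent M C (insertAt S i false) → Independent M C (insertAt S i true)
Independent-extend M C S i row∉ indep T T⊆S⁺ T≠∅ vanish with insertAtView i T
... | insertAt-view T₀ false = indep (insertAt T₀ i false) T⊆S T≠∅ vanish
  where
  T⊆S : insertAt T₀ i false ⊆ₛ insertAt S i false
  T⊆S = from (⊆ₛ-insertAt⇔ T₀ S i false false)
             ((λ ()) , proj₂ (to (⊆ₛ-insertAt⇔ T₀ S i false true) T⊆S⁺))
... | insertAt-view T₀ true  = row∉ (InSpan-resp row≗ (InSpan-rowSum M C T′ (insertAt S i false) T′⊆S))
  where
  T′ : Subset (suc _)
  T′ = insertAt T₀ i false

  T′⊆S : T′ ⊆ₛ insertAt S i false
  T′⊆S = from (⊆ₛ-insertAt⇔ T₀ S i false false)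
              ((λ ()) , proj₂ (to (⊆ₛ-insertAt⇔ T₀ S i true true) T⊆S⁺))

  row≗ : restrict C (rowSum M T′) ≗ restrict C (M i)
  row≗ = restrict-cong {C = C} λ j Cj → xor≡false⇒≡ (begin
    M i j xor rowSum M T′ j      ≡⟨ cong (M i j xor_) (rowComb≡xsum M T′ j) ⟨
    M i j xor rowComb M T′ j     ≡⟨ cong (M i j xor_) (rowComb-insertAt M T₀ i false j) ⟩
    M i j xor xsum (λ k → mem T₀ k ∧ M (punchIn i k) j)
                                 ≡⟨ rowComb-insertAt M T₀ i true j ⟨
    rowComb M T j                ≡⟨ vanish j Cj ⟩
    false                        ∎)
    where open ≡-Reasoning

RowBasis-spans : {M : Mat n} {R C : Subset n} (B : RowBasis M R C) (i : Fin n) →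
                 mem R i ≡ true → InSpan (rowList M C (RowBasis.rows B)) (restrict C (M i))
RowBasis-spans {suc n} {M} {R} {C} B i Ri with InSpan? (rowList M C (RowBasis.rows B)) (restrict C (M i))
... | yes row∈ = row∈
... | no  row∉ = ⊥-elim (extend (insertAtView i rows) row∉ rows⊆R independent ∣rows∣≡rank)
  where
  open RowBasis B
  -- a row outside the span could be added to the basis, contradicting maximality
  extend : ∀ {S} → InsertAtView i S → ¬ InSpan (rowList M C S) (restrict C (M i)) →
           S ⊆ₛ R → Independent M C S → ∣ S ∣ ≡ rankSub M R C → ⊥
  extend (insertAt-view S true)  row∉ _ _ _ =
    row∉ (InSpan-∈ (∈-rowList M C (insertAt S i true) i (insertAt-lookup S i true)))
  extend (insertAt-view S false) row∉ S⊆R indep ∣S∣≡rank = 1+n≰n (begin-strict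
    rankSub M R C                ≡⟨ ∣S∣≡rank ⟨
    ∣ insertAt S i false ∣        ≡⟨ ∣insertAt∣ S i false ⟩
    ∣ S ∣                         <⟨ ≤-refl ⟩
    suc ∣ S ∣                     ≡⟨ ∣insertAt∣ S i true ⟨
    ∣ insertAt S i true ∣         ≤⟨ ∣S∣≤rankSub M R C (insertAt S i true) S⁺⊆R
                                     (Independent-extend M C S i row∉ indep) ⟩
    rankSub M R C                ∎)
    where
    open ≤-Reasoning
    S⁺⊆R : insertAt S i true ⊆ₛ R
    S⁺⊆R = punchIn-cases i (λ _ → Ri) λ k S⁺k →
      S⊆R (punchIn i k) (trans (insertAt-punchIn S i false k) (trans (sym (insertAt-punchIn S i true k)) S⁺k))

_⊕ₘ_ : Mat n → Mat n → Mat n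
(X ⊕ₘ Y) i j = X i j xor Y i j

rankSub-subadditive : (X Y : Mat n) (R C : Subset n) → rankSub (X ⊕ₘ Y) R C ≤ rankSub X R C + rankSub Y R C
rankSub-subadditive X Y R C = begin
  rankSub (X ⊕ₘ Y) R C                    ≡⟨ ∣rows∣≡rank B ⟨
  ∣ rows B ∣                               ≡⟨ length-rowList (X ⊕ₘ Y) C (rows B) ⟨
  length (rowList (X ⊕ₘ Y) C (rows B))    ≤⟨ steinitz (L₁ ++ L₂) B-independent B-spanned ⟩
  length (L₁ ++ L₂)                        ≡⟨ length-++ L₁ ⟩
  length L₁ + length L₂                    ≡⟨ cong₂ _+_ (length-rowList X C (rows B₁)) (length-rowList Y C (rows B₂)) ⟩
  ∣ rows B₁ ∣ + ∣ rows B₂ ∣                  ≡⟨ cong₂ _+_ (∣rows∣≡rank B₁) (∣rows∣≡rank B₂) ⟩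
  rankSub X R C + rankSub Y R C            ∎
  where
  open ≤-Reasoning
  open RowBasis
  B : RowBasis (X ⊕ₘ Y) R C
  B = rowBasis (X ⊕ₘ Y) R C
  B₁ : RowBasis X R C
  B₁ = rowBasis X R C
  B₂ : RowBasis Y R C
  B₂ = rowBasis Y R C
  L₁ L₂ : List (Vector Bool _)
  L₁ = rowList X C (rows B₁)
  L₂ = rowList Y C (rows B₂)

  B-independent : IndependentOver [] (rowList (X ⊕ₘ Y) C (rows B))
  B-independent = Independent⇒IndependentOver (X ⊕ₘ Y) C (rows B) (independent B)

  B-spanned : All (InSpan ((L₁ ++ L₂) ++ [])) (rowList (X ⊕ₘ Y) C (rows B))
  B-spanned = All-rowList (X ⊕ₘ Y) C (rows B) λ i Bi → let Ri = rows⊆R B i Bi in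
    InSpan-⊕ (⊆⇒⊑ (xs⊆xs++ys _ [] ∘ xs⊆xs++ys L₁ L₂) (RowBasis-spans B₁ i Ri))
             (⊆⇒⊑ (xs⊆xs++ys _ [] ∘ xs⊆ys++xs L₂ L₁) (RowBasis-spans B₂ i Ri))
             (λ j → ∧-distribˡ-xor (mem C j) (X i j) (Y i j))

addI-off : (M : Mat n) (A : Subset n) {i j : Fin n} → i ≢ j → addI M A i j ≡ M i j
addI-off M A {i} {j} i≢j = cong (λ x → if x then M i j xor mem A i else M i j) (dec-false (i ≟ j) i≢j)

addI-diag : (M : Mat n) (A : Subset n) (i : Fin n) → addI M A i i ≡ M i i xor mem A i
addI-diag M A i = cong (λ x → if x then M i i xor mem A i else M i i) (dec-true (i ≟ i) refl)

𝟎 : Mat n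
𝟎 _ _ = false

rowComb-addI-𝟎 : (A T : Subset n) (j : Fin n) → rowComb (addI 𝟎 A) T j ≡ mem T j ∧ mem A j
rowComb-addI-𝟎 {suc n} A T j = begin
  rowComb (addI 𝟎 A) T j
    ≡⟨ rowComb≡xsum (addI 𝟎 A) T j ⟩
  xsum (λ i → mem T i ∧ addI 𝟎 A i j)
    ≡⟨ sum-remove {i = j} (λ i → mem T i ∧ addI 𝟎 A i j) ⟩
  (mem T j ∧ addI 𝟎 A j j) xor xsum (λ k → mem T (punchIn j k) ∧ addI 𝟎 A (punchIn j k) j)
    ≡⟨ cong₂ _xor_ (cong (mem T j ∧_) (addI-diag 𝟎 A j))
                   (xsum-zero λ k → trans (cong (mem T (punchIn j k) ∧_) (addI-off 𝟎 A (punchInᵢ≢i j k)))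
                                          (∧-zeroʳ _)) ⟩
  (mem T j ∧ mem A j) xor false
    ≡⟨ xor-identityʳ _ ⟩
  mem T j ∧ mem A j
    ∎
  where open ≡-Reasoning

∣A∣≤prank+prank-addI : (M : Mat n) (A : Subset n) → ∣ A ∣ ≤ prank M A + prank (addI M A) A
∣A∣≤prank+prank-addI M A = begin
  ∣ A ∣                              ≤⟨ ∣S∣≤rankSub (addI 𝟎 A) A A A (λ _ Ai → Ai) I-independent ⟩
  prank (addI 𝟎 A) A                 ≡⟨ rankSub-cong M⊕M+I≡I A A ⟨
  prank (M ⊕ₘ addI M A) A            ≤⟨ rankSub-subadditive M (addI M A) A A ⟩
  prank M A + prank (addI M A) A     ∎
  where
  open ≤-Reasoning
  I-independent : Independent (addI 𝟎 A) A A
  I-independent T T⊆A (i , Ti) vanish =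
    contradiction (trans (sym (vanish i (T⊆A i Ti))) (trans (rowComb-addI-𝟎 A T i) (cong₂ _∧_ Ti (T⊆A i Ti)))) λ ()

  M⊕M+I≡I : ∀ i j → (M ⊕ₘ addI M A) i j ≡ addI 𝟎 A i j
  M⊕M+I≡I i j with does (i ≟ j)
  ... | true  = xor-cancelˡ (M i j) (mem A i)
  ... | false = xor-same (M i j)

pcorank≤rank-addI : (M : Mat n) (A : Subset n) → pcorank M A ≤ rank (addI M A)
pcorank≤rank-addI M A =
  ≤-trans (m≤n+o⇒m∸n≤o ∣ A ∣ (prank M A) (∣A∣≤prank+prank-addI M A)) (prank≤rank (addI M A) A)

pcorank-addI≤rank : (M : Mat n) (A : Subset n) → pcorank (addI M A) A ≤ rank M
pcorank-addI≤rank M A = ≤-trans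
  (m≤n+o⇒m∸n≤o ∣ A ∣ (prank (addI M A) A) (subst (∣ A ∣ ≤_) (+-comm (prank M A) _) (∣A∣≤prank+prank-addI M A)))
  (prank≤rank M A)

-- Ranks at an isolated vertex

Isolated : Mat (suc n) → Fin (suc n) → Set
Isolated M v = ∀ u → u ≢ v → (M u v ≡ false) × (M v u ≡ false)

module _ {N : Mat (suc n)} {v : Fin (suc n)} (iso : Isolated N v) where

  private
    N′ : Mat n
    N′ = deleteVertex v N
    d : Bool
    d = N v v

  rowComb-isolated-at : (T : Subset n) (t : Bool) → rowComb N (insertAt T v t) v ≡ t ∧ d
  rowComb-isolated-at T t = begin
    rowComb N (insertAt T v t) v                                ≡⟨ rowComb-insertAt N T v t v ⟩
    (t ∧ d) xor xsum (λ k → mem T k ∧ N (punchIn v k) v)        ≡⟨ cong ((t ∧ d) xor_) (xsum-zero column-v) ⟩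
    (t ∧ d) xor false                                           ≡⟨ xor-identityʳ _ ⟩
    t ∧ d                                                       ∎
    where
    open ≡-Reasoning
    column-v : ∀ k → mem T k ∧ N (punchIn v k) v ≡ false
    column-v k = trans (cong (mem T k ∧_) (proj₁ (iso (punchIn v k) (punchInᵢ≢i v k)))) (∧-zeroʳ _)

  rowComb-isolated-off : (T : Subset n) (t : Bool) (l : Fin n) →
                         rowComb N (insertAt T v t) (punchIn v l) ≡ rowComb N′ T l
  rowComb-isolated-off T t l = begin
    rowComb N (insertAt T v t) (punchIn v l)                    ≡⟨ rowComb-insertAt N T v t (punchIn v l) ⟩
    (t ∧ N v (punchIn v l)) xor rowSum N′ T l                   ≡⟨ cong (λ x → (t ∧ x) xor rowSum N′ T l)
                                                                        (proj₂ (iso (punchIn v l) (punchInᵢ≢i v l))) ⟩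
    (t ∧ false) xor rowSum N′ T l                               ≡⟨ cong (_xor rowSum N′ T l) (∧-zeroʳ t) ⟩
    rowSum N′ T l                                               ≡⟨ rowComb≡xsum N′ T l ⟨
    rowComb N′ T l                                              ∎
    where open ≡-Reasoning

  Independent-isolated⇔ : (C S : Subset n) (c s : Bool) →
    Independent N (insertAt C v c) (insertAt S v s) ⇔ ((s ≡ true → c ∧ d ≡ true) × Independent N′ C S)
  Independent-isolated⇔ C S c s = mk⇔ (λ indep → pivot indep , restricted indep) extended
    where
    vanish-off : ∀ {T t} → VanishesOn C (rowComb N′ T) → VanishesOn C (rowComb N (insertAt T v t) ∘ punchIn v)
    vanish-off {T} {t} vanish l Cl = trans (rowComb-isolated-off T t l) (vanish l Cl)

    pivot : Independent N (insertAt C v c) (insertAt S v s) → s ≡ true → c ∧ d ≡ true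
    pivot indep s≡true with c ∧ d in cd
    ... | true  = refl
    ... | false = ⊥-elim (indep (insertAt ∅ v true)
      (from (⊆ₛ-insertAt⇔ ∅ S v true s) ((λ _ → s≡true) , ∅⊆ₛ S))
      (from (Inhabited-insertAt⇔ ∅ v true) (inj₁ refl))
      (from (VanishesOn-insertAt⇔ C v c _)
        ( (λ c≡true → trans (rowComb-isolated-at ∅ true) (trans (sym (cong (_∧ d) c≡true)) cd))
        , vanish-off {∅} λ l _ → trans (rowComb≡xsum N′ ∅ l) (xsum-zero λ k → cong (_∧ N′ k l) (mem-∅ k)))))

    restricted : Independent N (insertAt C v c) (insertAt S v s) → Independent N′ C S
    restricted indep T T⊆S T≠∅ vanish = indep (insertAt T v false)
      (from (⊆ₛ-insertAt⇔ T S v false s) ((λ ()) , T⊆S))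
      (from (Inhabited-insertAt⇔ T v false) (inj₂ T≠∅))
      (from (VanishesOn-insertAt⇔ C v c _) ((λ _ → rowComb-isolated-at T false) , vanish-off vanish))

    extended : (s ≡ true → c ∧ d ≡ true) × Independent N′ C S → Independent N (insertAt C v c) (insertAt S v s)
    extended (s⇒cd , indep) T T⊆S⁺ T≠∅ vanish with insertAtView v T
    ... | insertAt-view T₀ true =
      let c≡true , d≡true = to (∧≡true⇔ c d) (s⇒cd (proj₁ (to (⊆ₛ-insertAt⇔ T₀ S v true s) T⊆S⁺) refl))
          d≡false = trans (sym (rowComb-isolated-at T₀ true)) (proj₁ (to (VanishesOn-insertAt⇔ C v c _) vanish) c≡true)
      in contradiction (trans (sym d≡true) d≡false) λ ()
    ... | insertAt-view T₀ false = indep T₀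
      (proj₂ (to (⊆ₛ-insertAt⇔ T₀ S v false s) T⊆S⁺))
      (inhabited (to (Inhabited-insertAt⇔ T₀ v false) T≠∅))
      (λ l Cl → trans (sym (rowComb-isolated-off T₀ false l)) (proj₂ (to (VanishesOn-insertAt⇔ C v c _) vanish) l Cl))
      where
      inhabited : false ≡ true ⊎ Inhabited T₀ → Inhabited T₀
      inhabited (inj₂ T₀≠∅) = T₀≠∅

  rankSub-isolated : (R C : Subset n) (r c : Bool) →
                     rankSub N (insertAt R v r) (insertAt C v c) ≡ bit (r ∧ c ∧ d) + rankSub N′ R C
  rankSub-isolated R C r c = ≤-antisym upper lower
    where
    open ≤-Reasoning
    x : Bool
    x = r ∧ c ∧ d

    bound : ∀ {S} → InsertAtView v S → S ⊆ₛ insertAt R v r → Independent N (insertAt C v c) S →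
            ∣ S ∣ ≤ bit x + rankSub N′ R C
    bound (insertAt-view S s) S⊆R indep =
      let s⇒r , S⊆R = to (⊆ₛ-insertAt⇔ S R v s r) S⊆R
          s⇒cd , S-indep = to (Independent-isolated⇔ C S c s) indep
      in begin
        ∣ insertAt S v s ∣             ≡⟨ ∣insertAt∣ S v s ⟩
        bit s + ∣ S ∣                  ≤⟨ +-mono-≤ (bit-mono λ s≡true → from (∧≡true⇔ r _) (s⇒r s≡true , s⇒cd s≡true))
                                                    (∣S∣≤rankSub N′ R C S S⊆R S-indep) ⟩
        bit x + rankSub N′ R C         ∎

    upper : rankSub N (insertAt R v r) (insertAt C v c) ≤ bit x + rankSub N′ R C
    upper = let open RowBasis (rowBasis N (insertAt R v r) (insertAt C v c)) in
      subst (_≤ bit x + rankSub N′ R C) ∣rows∣≡rank (bound (insertAtView v rows) rows⊆R independent)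

    lower : bit x + rankSub N′ R C ≤ rankSub N (insertAt R v r) (insertAt C v c)
    lower = let open RowBasis (rowBasis N′ R C) in begin
      bit x + rankSub N′ R C                        ≡⟨ cong (bit x +_) ∣rows∣≡rank ⟨
      bit x + ∣ rows ∣                              ≡⟨ ∣insertAt∣ rows v x ⟨
      ∣ insertAt rows v x ∣                         ≤⟨ ∣S∣≤rankSub N (insertAt R v r) (insertAt C v c) (insertAt rows v x)
           (from (⊆ₛ-insertAt⇔ rows R v x r) (proj₁ ∘ to (∧≡true⇔ r _) , rows⊆R))
           (from (Independent-isolated⇔ C rows c x) (proj₂ ∘ to (∧≡true⇔ r _) , independent)) ⟩
      rankSub N (insertAt R v r) (insertAt C v c)   ∎

  prank-isolated : (A : Subset n) (a : Bool) → prank N (insertAt A v a) ≡ bit (a ∧ d) + prank N′ A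
  prank-isolated A a = trans (rankSub-isolated A A a a) (cong (λ x → bit x + prank N′ A) (∧-idem-assoc a))
    where
    ∧-idem-assoc : ∀ a → a ∧ a ∧ d ≡ a ∧ d
    ∧-idem-assoc false = refl
    ∧-idem-assoc true  = refl

  pcorank-isolated : (A : Subset n) (a : Bool) → pcorank N (insertAt A v a) ≡ bit (a ∧ not d) + pcorank N′ A
  pcorank-isolated A a = begin
    ∣ insertAt A v a ∣ ∸ prank N (insertAt A v a)   ≡⟨ cong₂ _∸_ (∣insertAt∣ A v a) (prank-isolated A a) ⟩
    (bit a + ∣ A ∣) ∸ (bit (a ∧ d) + prank N′ A)    ≡⟨ bit-∸ a d (prank≤∣A∣ N′ A) ⟩
    bit (a ∧ not d) + (∣ A ∣ ∸ prank N′ A)          ∎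
    where
    open ≡-Reasoning
    bit-∸ : ∀ a d {m p} → p ≤ m → (bit a + m) ∸ (bit (a ∧ d) + p) ≡ bit (a ∧ not d) + (m ∸ p)
    bit-∸ false d     _   = refl
    bit-∸ true  true  _   = refl
    bit-∸ true  false p≤m = +-∸-assoc 1 p≤m

  rank-isolated : rank N ≡ bit d + rank N′
  rank-isolated = trans (cong (prank N) (⊤≡insertAt v)) (prank-isolated ⊤ true)
    where
    ⊤≡insertAt : ∀ {n} (v : Fin (suc n)) → ⊤ ≡ insertAt ⊤ v true
    ⊤≡insertAt           fzero    = refl
    ⊤≡insertAt {suc _}   (fsuc v) = cong (true ∷_) (⊤≡insertAt v)

module _ {M : Mat (suc n)} {v : Fin (suc n)} (iso : Isolated M v) where

  private
    M′ : Mat n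
    M′ = deleteVertex v M
    d : Bool
    d = M v v

  addI-isolated : (A : Subset (suc n)) → Isolated (addI M A) v
  addI-isolated A u u≢v = trans (addI-off M A u≢v) (proj₁ (iso u u≢v))
                        , trans (addI-off M A (u≢v ∘ sym)) (proj₂ (iso u u≢v))

  addI-diagonal : (A : Subset n) (t : Bool) → addI M (insertAt A v t) v v ≡ d xor t
  addI-diagonal A t = trans (addI-diag M (insertAt A v t) v) (cong (d xor_) (insertAt-lookup A v t))

  deleteVertex-addI : (A : Subset n) (t : Bool) (i j : Fin n) →
                      deleteVertex v (addI M (insertAt A v t)) i j ≡ addI M′ A i j
  deleteVertex-addI A t i j with i ≟ j
  ... | yes refl = trans (addI-diag M (insertAt A v t) (punchIn v i)) (cong (M′ i i xor_) (insertAt-punchIn A v t i))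
  ... | no  i≢j  = addI-off M (insertAt A v t) (i≢j ∘ punchIn-injective v i j)

  prank-addI-isolated : (A B : Subset n) (t b : Bool) →
                        prank (addI M (insertAt A v t)) (insertAt B v b) ≡ bit (b ∧ (d xor t)) + prank (addI M′ A) B
  prank-addI-isolated A B t b = trans (prank-isolated (addI-isolated (insertAt A v t)) B b)
    (cong₂ (λ x y → bit (b ∧ x) + y) (addI-diagonal A t) (rankSub-cong (deleteVertex-addI A t) B B))

  rank-addI-isolated : (A : Subset n) (t : Bool) → rank (addI M (insertAt A v t)) ≡ bit (d xor t) + rank (addI M′ A)
  rank-addI-isolated A t = trans (rank-isolated (addI-isolated (insertAt A v t)))
    (cong₂ (λ x y → bit x + y) (addI-diagonal A t) (rankSub-cong (deleteVertex-addI A t) ⊤ ⊤))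

  pcorank-addI-isolated : (A : Subset n) (t : Bool) →
    pcorank (addI M (insertAt A v t)) (insertAt A v t) ≡ bit (t ∧ not (d xor t)) + pcorank (addI M′ A) A
  pcorank-addI-isolated A t = trans (pcorank-isolated (addI-isolated (insertAt A v t)) A t)
    (cong₂ (λ x y → bit (t ∧ not x) + (∣ A ∣ ∸ y)) (addI-diagonal A t) (rankSub-cong (deleteVertex-addI A t) A A))

sum-map-+ : ∀ {A : Set} (f g : A → ℕ) (xs : List A) →
            sum (map (λ x → f x + g x) xs) ≡ sum (map f xs) + sum (map g xs)
sum-map-+ f g []       = refl
sum-map-+ f g (x ∷ xs) = trans (cong (f x + g x +_) (sum-map-+ f g xs)) (interchange (f x) (g x) _ _)

sum-map-*ˡ : ∀ {A : Set} (k : ℕ) (f : A → ℕ) (xs : List A) → sum (map (λ x → k * f x) xs) ≡ k * sum (map f xs)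
sum-map-*ˡ k f []       = sym (*-zeroʳ k)
sum-map-*ˡ k f (x ∷ xs) = trans (cong (k * f x +_) (sum-map-*ˡ k f xs)) (sym (*-distribˡ-+ k (f x) _))

sum-allSubsets-suc : (f : Subset (suc n) → ℕ) →
  sum (map f (allSubsets (suc n)))
    ≡ sum (map (f ∘ (false ∷_)) (allSubsets n)) + sum (map (f ∘ (true ∷_)) (allSubsets n))
sum-allSubsets-suc {n} f = begin
  sum (map f (map (false ∷_) (allSubsets n) ++ map (true ∷_) (allSubsets n)))
    ≡⟨ cong sum (map-++ f (map (false ∷_) (allSubsets n)) _) ⟩
  sum (map f (map (false ∷_) (allSubsets n)) ++ map f (map (true ∷_) (allSubsets n)))
    ≡⟨ sum-++ (map f (map (false ∷_) (allSubsets n))) _ ⟩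
  sum (map f (map (false ∷_) (allSubsets n))) + sum (map f (map (true ∷_) (allSubsets n)))
    ≡⟨ cong₂ (λ xs ys → sum xs + sum ys) (map-∘ (allSubsets n)) (map-∘ (allSubsets n)) ⟨
  sum (map (f ∘ (false ∷_)) (allSubsets n)) + sum (map (f ∘ (true ∷_)) (allSubsets n)) ∎
  where open ≡-Reasoning

sum-allSubsets-insertAt : (v : Fin (suc n)) (f : Subset (suc n) → ℕ) →
  sum (map f (allSubsets (suc n))) ≡ sum (map (λ A → f (insertAt A v false) + f (insertAt A v true)) (allSubsets n))
sum-allSubsets-insertAt {n} fzero f =
  trans (sum-allSubsets-suc f) (sym (sum-map-+ (f ∘ (false ∷_)) (f ∘ (true ∷_)) (allSubsets n)))
sum-allSubsets-insertAt {suc n} (fsuc v) f = begin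
  sum (map f (allSubsets (suc (suc n))))
    ≡⟨ sum-allSubsets-suc f ⟩
  sum (map (f ∘ (false ∷_)) (allSubsets (suc n))) + sum (map (f ∘ (true ∷_)) (allSubsets (suc n)))
    ≡⟨ cong₂ _+_ (sum-allSubsets-insertAt v (f ∘ (false ∷_))) (sum-allSubsets-insertAt v (f ∘ (true ∷_))) ⟩
  sum (map (λ A → f (false ∷ insertAt A v false) + f (false ∷ insertAt A v true)) (allSubsets n))
    + sum (map (λ A → f (true ∷ insertAt A v false) + f (true ∷ insertAt A v true)) (allSubsets n))
    ≡⟨ sum-allSubsets-suc (λ A → f (insertAt A (fsuc v) false) + f (insertAt A (fsuc v) true)) ⟨
  sum (map (λ A → f (insertAt A (fsuc v) false) + f (insertAt A (fsuc v) true)) (allSubsets (suc n))) ∎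
  where open ≡-Reasoning

Δr : Variant → Bool → Bool → ℕ
Δr δ   d t = bit d
Δr τ   d t = bit (d xor t)
Δr δτ  d t = bit (d xor t)
Δr τδ  d t = bit (not t ∧ d)
Δr τδτ d t = bit (not t ∧ d)

c≡Σz^Δr : (b : Variant) (d : Bool) (z : ℕ) → c b d z ≡ z ^ Δr b d false + z ^ Δr b d true
c≡Σz^Δr δ   false z = refl
c≡Σz^Δr δ   true  z = trans (cong (z +_) (+-identityʳ z)) (sym (cong₂ _+_ (*-identityʳ z) (*-identityʳ z)))
c≡Σz^Δr τ   false z = trans (+-comm z 1) (cong suc (sym (*-identityʳ z)))
c≡Σz^Δr τ   true  z = cong (_+ 1) (sym (*-identityʳ z))
c≡Σz^Δr δτ  false z = trans (+-comm z 1) (cong suc (sym (*-identityʳ z)))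
c≡Σz^Δr δτ  true  z = cong (_+ 1) (sym (*-identityʳ z))
c≡Σz^Δr τδ  false z = refl
c≡Σz^Δr τδ  true  z = cong (_+ 1) (sym (*-identityʳ z))
c≡Σz^Δr τδτ false z = refl
c≡Σz^Δr τδτ true  z = cong (_+ 1) (sym (*-identityʳ z))

module _ {M : Mat (suc n)} {v : Fin (suc n)} (iso : Isolated M v) where

  private
    M′ : Mat n
    M′ = deleteVertex v M
    d : Bool
    d = M v v

  prank-∁-isolated : (A : Subset n) (t : Bool) → prank M (∁ (insertAt A v t)) ≡ bit (not t ∧ d) + prank M′ (∁ A)
  prank-∁-isolated A t = trans (cong (prank M) (map-insertAt not t A v)) (prank-isolated iso (∁ A) (not t))

  r-isolated : (b : Variant) (A : Subset n) (t : Bool) → r b M (insertAt A v t) ≡ Δr b d t + r b M′ A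
  r-isolated δ A t = begin
    prank M (insertAt A v t) + prank M (∁ (insertAt A v t))
      ≡⟨ cong₂ _+_ (prank-isolated iso A t) (prank-∁-isolated A t) ⟩
    (bit (t ∧ d) + prank M′ A) + (bit (not t ∧ d) + prank M′ (∁ A))
      ≡⟨ interchange (bit (t ∧ d)) _ _ _ ⟩
    (bit (t ∧ d) + bit (not t ∧ d)) + (prank M′ A + prank M′ (∁ A))
      ≡⟨ cong (_+ (prank M′ A + prank M′ (∁ A))) (bits t) ⟩
    bit d + (prank M′ A + prank M′ (∁ A))   ∎
    where
    open ≡-Reasoning
    bits : ∀ t → bit (t ∧ d) + bit (not t ∧ d) ≡ bit d
    bits false = refl
    bits true  = +-identityʳ (bit d)
  r-isolated τ A t = rank-addI-isolated iso A t
  r-isolated δτ A t = begin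
    prank (addI M (insertAt A v t)) (insertAt A v t) + prank M (∁ (insertAt A v t))
      ≡⟨ cong₂ _+_ (prank-addI-isolated iso A A t t) (prank-∁-isolated A t) ⟩
    (bit (t ∧ (d xor t)) + prank (addI M′ A) A) + (bit (not t ∧ d) + prank M′ (∁ A))
      ≡⟨ interchange (bit (t ∧ (d xor t))) _ _ _ ⟩
    (bit (t ∧ (d xor t)) + bit (not t ∧ d)) + (prank (addI M′ A) A + prank M′ (∁ A))
      ≡⟨ cong (_+ (prank (addI M′ A) A + prank M′ (∁ A))) (bits d t) ⟩
    bit (d xor t) + (prank (addI M′ A) A + prank M′ (∁ A))   ∎
    where
    open ≡-Reasoning
    bits : ∀ d t → bit (t ∧ (d xor t)) + bit (not t ∧ d) ≡ bit (d xor t)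
    bits false false = refl
    bits true  false = refl
    bits false true  = refl
    bits true  true  = refl
  r-isolated τδ A t = begin
    rank (addI M (insertAt A v t)) ∸ pcorank M (insertAt A v t)
      ≡⟨ cong₂ _∸_ (rank-addI-isolated iso A t) (pcorank-isolated iso A t) ⟩
    (bit (d xor t) + rank (addI M′ A)) ∸ (bit (t ∧ not d) + pcorank M′ A)
      ≡⟨ bits d t (pcorank≤rank-addI M′ A) ⟩
    bit (not t ∧ d) + (rank (addI M′ A) ∸ pcorank M′ A)   ∎
    where
    open ≡-Reasoning
    bits : ∀ d t {m k} → k ≤ m → (bit (d xor t) + m) ∸ (bit (t ∧ not d) + k) ≡ bit (not t ∧ d) + (m ∸ k)
    bits false false _   = refl
    bits true  false k≤m = +-∸-assoc 1 k≤m
    bits false true  _   = refl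
    bits true  true  _   = refl
  r-isolated τδτ A t = begin
    rank M ∸ pcorank (addI M (insertAt A v t)) (insertAt A v t)
      ≡⟨ cong₂ _∸_ (rank-isolated iso) (pcorank-addI-isolated iso A t) ⟩
    (bit d + rank M′) ∸ (bit (t ∧ not (d xor t)) + pcorank (addI M′ A) A)
      ≡⟨ bits d t (pcorank-addI≤rank M′ A) ⟩
    bit (not t ∧ d) + (rank M′ ∸ pcorank (addI M′ A) A)   ∎
    where
    open ≡-Reasoning
    bits : ∀ d t {m k} → k ≤ m → (bit d + m) ∸ (bit (t ∧ not (d xor t)) + k) ≡ bit (not t ∧ d) + (m ∸ k)
    bits false false _   = refl
    bits true  false k≤m = +-∸-assoc 1 k≤m
    bits false true  _   = refl
    bits true  true  _   = refl

  z^r-insertAt-pair : (b : Variant) (z : ℕ) (A : Subset n) →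
    z ^ r b M (insertAt A v false) + z ^ r b M (insertAt A v true) ≡ c b d z * z ^ r b M′ A
  z^r-insertAt-pair b z A = begin
    z ^ r b M (insertAt A v false) + z ^ r b M (insertAt A v true)
      ≡⟨ cong₂ _+_ (cong (z ^_) (r-isolated b A false)) (cong (z ^_) (r-isolated b A true)) ⟩
    z ^ (Δr b d false + r′) + z ^ (Δr b d true + r′)
      ≡⟨ cong₂ _+_ (^-distribˡ-+-* z (Δr b d false) r′) (^-distribˡ-+-* z (Δr b d true) r′) ⟩
    z ^ Δr b d false * z ^ r′ + z ^ Δr b d true * z ^ r′
      ≡⟨ *-distribʳ-+ (z ^ r′) (z ^ Δr b d false) _ ⟨
    (z ^ Δr b d false + z ^ Δr b d true) * z ^ r′
      ≡⟨ cong (_* z ^ r′) (c≡Σz^Δr b d z) ⟨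
    c b d z * z ^ r′ ∎
    where
    open ≡-Reasoning
    r′ : ℕ
    r′ = r b M′ A

proposition3p3 : (n : ℕ) (M : Mat (suc n)) (v : Fin (suc n)) →
    (∀ u → u ≢ v → (M u v ≡ false) × (M v u ≡ false)) →
    (b : Variant) (z : ℕ) →
    P b M z ≡ c b (M v v) z * P b (deleteVertex v M) z
proposition3p3 n M v iso b z = begin
  P b M z
    ≡⟨ sum-allSubsets-insertAt v (λ A → z ^ r b M A) ⟩
  sum (map (λ A → z ^ r b M (insertAt A v false) + z ^ r b M (insertAt A v true)) (allSubsets n))
    ≡⟨ cong sum (map-cong (z^r-insertAt-pair iso b z) (allSubsets n)) ⟩
  sum (map (λ A → c b (M v v) z * z ^ r b (deleteVertex v M) A) (allSubsets n))
    ≡⟨ sum-map-*ˡ (c b (M v v) z) (λ A → z ^ r b (deleteVertex v M) A) (allSubsets n) ⟩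
  c b (M v v) z * P b (deleteVertex v M) z ∎
  where open ≡-Reasoning
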